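{- Let $a=(a_k)_{k\ge1}$ be a sequence of pairwise distinct complex numbers with $a_1=0$. (a) If $\mu,\lambda$ are strict partitions with $\mu\not\subset\lambda$, then $Q_{\mu;a}(x(\lambda))=P_{\mu;a}(x(\lambda))=0$. (b) For every strict partition $\mu$, $P_{\mu;a}(x(\mu))=H_a(\mu)$, where $$H_a(\mu)=\prod_{k=1}^{\ell(\mu)}(a_{\mu_k+1}\mid a)^{\mu_k}\prod_{1\le i<j\le\ell(\mu)}\frac{a_{\mu_i+1}+a_{\mu_j+1}}{a_{\mu_i+1}-a_{\mu_j+1}}.$$
   Context: A strict partition is $\lambda=(\lambda_1>\dots>\lambda_l>0)$, $\ell(\lambda)=l$; for strict $\mu,\lambda$, $\mu\subset\lambda$ means the shifted diagram of $\mu$ is contained in that of $\lambda$, i.e. $\ell(\mu)\le\ell(\lambda)$ and $\mu_i\le\lambda_i$ for all $i\le\ell(\mu)$. Put $(x\mid a)^k=\prod_{m=1}^k(x-a_m)$, $(x\mid a)^0=1$. For $\ell(\mu)=l\le n$, $$P_{\mu;a}(x_1,\dots,x_n)=\frac1{(n-l)!}\sum_{\omega\in S(n)}\prod_{i=1}^l (x_{\omega(i)}\mid a)^{\mu_i}\prod_{1\le i\le l,\ i<j\le n}\frac{x_{\omega(i)}+x_{\omega(j)}}{x_{\omega(i)}-x_{\omega(j)}},$$ $P_{\mu;a}(x_1,\dots,x_n)=0$ if $\ell(\mu)>n$, and $Q_{\mu;a}=2^{\ell(\mu)}P_{\mu;a}$; these are stable under $x_{n+1}\mapsto 0$, so evaluating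 at a finite tuple is well defined. For a strict partition $\lambda$, $x(\lambda)$ denotes the tuple $(x(\lambda)_1,\dots,x(\lambda)_{\ell(\lambda)})$ with $x(\lambda)_i=a_{\lambda_i+1}$. -}

module Defs where

open import Level using (Level; _⊔_) renaming (suc to lsuc)
open import Algebra.Bundles using (CommutativeRing)
open import Data.Nat as ℕ using (ℕ; zero; suc; _≤?_)
open import Data.List using (List; []; _∷_; length; map; concatMap)
open import Data.Unit.Polymorphic using (⊤)
open import Data.Empty using (⊥)
open import Data.Product using (_×_)
open import Relation.Nullary using (¬_; yes; no)
open import Relation.Binary.PropositionalEquality using (_≡_)

-- Fields of characteristic zero (stand-in for ℂ).
-- The inverse is a total function, specified only on nonzero elements
-- (as with the convention 0⁻¹ = 0 in ℂ).

ofℕ : ∀ {c ℓ} (R : CommutativeRing c ℓ) → ℕ → CommutativeRing.Carrier R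
ofℕ R zero = CommutativeRing.0# R
ofℕ R (suc n) = CommutativeRing._+_ R (CommutativeRing.1# R) (ofℕ R n)

record Char0Field (c ℓ : Level) : Set (lsuc (c ⊔ ℓ)) where
  field
    commutativeRing : CommutativeRing c ℓ
  open CommutativeRing commutativeRing public
  field
    _⁻¹     : Carrier → Carrier
    ⁻¹-cong : ∀ {x y} → x ≈ y → x ⁻¹ ≈ y ⁻¹
    inverse : ∀ x → ¬ (x ≈ 0#) → x * (x ⁻¹) ≈ 1#
    char0   : ∀ n → ¬ (ofℕ commutativeRing (suc n) ≈ 0#)

data Strict : List ℕ → Set where
  strict-[]  : Strict []
  strict-one : ∀ {m} → 0 ℕ.< m → Strict (m ∷ [])
  strict-∷   : ∀ {m k r} → k ℕ.< m → Strict (k ∷ r) → Strict (m ∷ k ∷ r)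

-- containment of shifted diagrams: ℓ(μ) ≤ ℓ(λ) and μᵢ ≤ λᵢ for i ≤ ℓ(μ)
data _⊂_ : List ℕ → List ℕ → Set where
  ⊂-[] : ∀ {λ′} → [] ⊂ λ′
  ⊂-∷  : ∀ {m l μ λ′} → m ℕ.≤ l → μ ⊂ λ′ → (m ∷ μ) ⊂ (l ∷ λ′)

-- All orderings (x_{ω(1)},…,x_{ω(n)}), ω ∈ S(n), of a tuple (with
-- multiplicity: exactly n! lists, one per permutation ω).

insertions : ∀ {a} {A : Set a} → A → List A → List (List A)
insertions x [] = (x ∷ []) ∷ []
insertions x (y ∷ ys) = (x ∷ y ∷ ys) ∷ map (y ∷_) (insertions x ys)

perms : ∀ {a} {A : Set a} → List A → List (List A)
perms [] = [] ∷ []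
perms (x ∷ xs) = concatMap (insertions x) (perms xs)

module FactorialQ {c ℓ} (F : Char0Field c ℓ) where
  open Char0Field F

  -- a is indexed from 1: a k is a_k for k ≥ 1 (a 0 is never used)
  Seq : Set c
  Seq = ℕ → Carrier

  sumL : List Carrier → Carrier
  sumL [] = 0#
  sumL (x ∷ xs) = x + sumL xs

  pow : Carrier → ℕ → Carrier
  pow x zero = 1#
  pow x (suc n) = x * pow x n

  factorial : ℕ → ℕ
  factorial zero = 1
  factorial (suc n) = suc n ℕ.* factorial n

  fpow : Seq → Carrier → ℕ → Carrier
  fpow a x zero = 1#
  fpow a x (suc k) = fpow a x k * (x - a (suc k))

  ratProd : Carrier → List Carrier → Carrier
  ratProd y [] = 1#
  ratProd y (z ∷ zs) = ((y + z) * ((y - z) ⁻¹)) * ratProd y zs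

  term : Seq → List ℕ → List Carrier → Carrier
  term a [] ys = 1#
  term a (m ∷ μ) [] = 0#   -- only reached when l > n, which is excluded below
  term a (m ∷ μ) (y ∷ ys) = (fpow a y m * ratProd y ys) * term a μ ys

  P : Seq → List ℕ → List Carrier → Carrier
  P a μ xs with length μ ≤? length xs
  ... | yes _ = (ofℕ commutativeRing (factorial (length xs ℕ.∸ length μ)) ⁻¹)
                  * sumL (map (term a μ) (perms xs))
  ... | no _  = 0#

  Q : Seq → List ℕ → List Carrier → Carrier
  Q a μ xs = pow (1# + 1#) (length μ) * P a μ xs

  xOf : Seq → List ℕ → List Carrier
  xOf a λ′ = map (λ k → a (suc k)) λ′

  pairProd : List Carrier → Carrier
  pairProd [] = 1#
  pairProd (u ∷ us) = ratProd u us * pairProd us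

  diagProd : Seq → List ℕ → Carrier
  diagProd a [] = 1#
  diagProd a (m ∷ μ) = fpow a (a (suc m)) m * diagProd a μ

  H : Seq → List ℕ → Carrier
  H a μ = diagProd a μ * pairProd (xOf a μ)

  Admissible : Seq → Set ℓ
  Admissible a = (a 1 ≈ 0#) ×
    (∀ i j → 1 ℕ.≤ i → 1 ℕ.≤ j → a i ≈ a j → i ≡ j)

{-# OPTIONS --safe #-}
module Submission where

-- Write an ordering of x(λ) as (a_{k₁+1}, a_{k₂+1}, …) with (k₁, k₂, …) an
-- ordering of λ. The factor (a_{kᵢ+1} | a)^{μᵢ} of its term contains
-- a_{kᵢ+1} − a_{kᵢ+1} = 0 whenever μᵢ > kᵢ, so only orderings k with μ ⊂ k
-- (⊂ read on lists: μᵢ ≤ kᵢ for i ≤ ℓ(μ)) contribute. For strict μ and λ such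
-- an ordering forces μ ⊂ λ (drop the head of μ and the entry of k inserted
-- last, then induct), which gives (a). For λ = μ the only contributing
-- ordering is μ itself and the normalisation 1/(n − ℓ(μ))! is 1, so
-- P_{μ;a}(x(μ)) is the single term H_a(μ).

open import Defs
open import Function using (_∘_)
open import Data.Nat using (ℕ; suc; _<_; _≤_; _≤?_; _∸_)
open import Data.Nat.Properties using (≤-refl; ≤-reflexive; ≤-trans; <-trans; <⇒≤; <⇒≱; ≰⇒>; m<1+n⇒m<n∨m≡n; n∸n≡0)
open import Data.List using (List; []; _∷_; _++_; map; concatMap; length)
open import Data.List.Properties using (map-∘; map-++; length-map; concatMap-map; concatMap-cong; map-concatMap)
open import Data.List.Membership.Propositional using (_∈_; find)
open import Data.List.Membership.Propositional.Properties using (∈-map⁻; ∈-concatMap⁻)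
open import Data.List.Relation.Unary.Any using (here; there)
open import Data.List.Relation.Unary.All as All using (All; []; _∷_)
open import Data.List.Relation.Binary.Permutation.Propositional using (_↭_; prep; swap; ↭-refl; ↭-sym; ↭-trans)
open import Data.List.Relation.Binary.Permutation.Propositional.Properties using (All-resp-↭)
open import Data.Product using (_×_; _,_)
open import Data.Sum using (inj₁; inj₂)
open import Relation.Nullary using (¬_; yes; no; contradiction)
open import Relation.Binary.PropositionalEquality as ≡ using (_≡_)

∈-insertions⇒↭ : ∀ {p} {A : Set p} {x : A} zs {ys} → ys ∈ insertions x zs → ys ↭ x ∷ zs
∈-insertions⇒↭ []       (here ≡.refl) = ↭-refl
∈-insertions⇒↭ (z ∷ zs) (here ≡.refl) = ↭-refl
∈-insertions⇒↭ {x = x} (z ∷ zs) (there p) with ∈-map⁻ (z ∷_) p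
... | ys , ys∈ , ≡.refl = ↭-trans (prep z (∈-insertions⇒↭ zs ys∈)) (swap z x ↭-refl)

∈-perms⇒↭ : ∀ {p} {A : Set p} xs {ys : List A} → ys ∈ perms xs → ys ↭ xs
∈-perms⇒↭ []       (here ≡.refl) = ↭-refl
∈-perms⇒↭ (x ∷ xs) p with find (∈-concatMap⁻ (insertions x) {xs = perms xs} p)
... | zs , zs∈ , ys∈ = ↭-trans (∈-insertions⇒↭ zs ys∈) (prep x (∈-perms⇒↭ xs zs∈))

insertions-map : ∀ {p q} {A : Set p} {B : Set q} (f : A → B) x ys →
  insertions (f x) (map f ys) ≡ map (map f) (insertions x ys)
insertions-map f x []       = ≡.refl
insertions-map f x (y ∷ ys) = ≡.cong ((f x ∷ f y ∷ map f ys) ∷_) (begin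
  map (f y ∷_) (insertions (f x) (map f ys))   ≡⟨ ≡.cong (map (f y ∷_)) (insertions-map f x ys) ⟩
  map (f y ∷_) (map (map f) (insertions x ys)) ≡⟨ map-∘ (insertions x ys) ⟨
  map (map f ∘ (y ∷_)) (insertions x ys)       ≡⟨ map-∘ (insertions x ys) ⟩
  map (map f) (map (y ∷_) (insertions x ys))   ∎)
  where open ≡.≡-Reasoning

perms-map : ∀ {p q} {A : Set p} {B : Set q} (f : A → B) xs → perms (map f xs) ≡ map (map f) (perms xs)
perms-map f []       = ≡.refl
perms-map f (x ∷ xs) = begin
  concatMap (insertions (f x)) (perms (map f xs))         ≡⟨ ≡.cong (concatMap _) (perms-map f xs) ⟩
  concatMap (insertions (f x)) (map (map f) (perms xs))   ≡⟨ concatMap-map (insertions (f x)) (map f) (perms xs) ⟩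
  concatMap (insertions (f x) ∘ map f) (perms xs)         ≡⟨ concatMap-cong (insertions-map f x) (perms xs) ⟩
  concatMap (map (map f) ∘ insertions x) (perms xs)       ≡⟨ map-concatMap (map f) (insertions x) (perms xs) ⟨
  map (map f) (concatMap (insertions x) (perms xs))       ∎
  where open ≡.≡-Reasoning

strict-tail : ∀ {m μ} → Strict (m ∷ μ) → Strict μ
strict-tail (strict-one _) = strict-[]
strict-tail (strict-∷ _ s) = s

strict-tail-<-head : ∀ {m μ} → Strict (m ∷ μ) → All (_< m) μ
strict-tail-<-head (strict-one _)   = []
strict-tail-<-head (strict-∷ k<m s) = k<m ∷ All.map (λ j<k → <-trans j<k k<m) (strict-tail-<-head s)

⊂-insertions : ∀ {m μ l zs ys} → Strict (m ∷ μ) → ys ∈ insertions l zs → (m ∷ μ) ⊂ ys → μ ⊂ zs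
⊂-insertions {zs = []}    _ (here ≡.refl) (⊂-∷ _ μ⊂) = μ⊂
⊂-insertions {zs = _ ∷ _} _ (here ≡.refl) (⊂-∷ _ μ⊂) = μ⊂
⊂-insertions {zs = z ∷ zs} s (there p) μ⊂ with ∈-map⁻ (z ∷_) p
⊂-insertions _ _ (⊂-∷ _ ⊂-[]) | _ , _ , ≡.refl = ⊂-[]
⊂-insertions (strict-∷ m′<m s) _ (⊂-∷ m≤z μ⊂) | _ , ys∈ , ≡.refl =
  ⊂-∷ (≤-trans (<⇒≤ m′<m) m≤z) (⊂-insertions s ys∈ μ⊂)

⊂-perms : ∀ {λ′ ys μ} → Strict λ′ → ys ∈ perms λ′ → Strict μ → μ ⊂ ys → μ ⊂ λ′
⊂-perms {[]} _ (here ≡.refl) _ μ⊂ = μ⊂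
⊂-perms {_ ∷ _} _ _ _ ⊂-[] = ⊂-[]
⊂-perms {l ∷ λ′} sλ p sμ (⊂-∷ {l = y} m≤y μ⊂) with find (∈-concatMap⁻ (insertions l) {xs = perms λ′} p)
... | zs , zs∈ , ys∈ = ⊂-∷ (≤-trans m≤y y≤l)
  (⊂-perms (strict-tail sλ) zs∈ (strict-tail sμ) (⊂-insertions sμ ys∈ (⊂-∷ m≤y μ⊂)))
  where
  y≤l : y ≤ l
  y≤l = All.head (All-resp-↭ (↭-sym (∈-perms⇒↭ (l ∷ λ′) p))
                   (≤-refl ∷ All.map <⇒≤ (strict-tail-<-head sλ)))

module Sums {c ℓ} (F : Char0Field c ℓ) where
  open Char0Field F
  open FactorialQ F
  open import Relation.Binary.Reasoning.Setoid setoid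

  sumL-++ : ∀ xs ys → sumL (xs ++ ys) ≈ sumL xs + sumL ys
  sumL-++ []       ys = sym (+-identityˡ _)
  sumL-++ (x ∷ xs) ys = trans (+-congˡ (sumL-++ xs ys)) (sym (+-assoc _ _ _))

  sumL-concatMap : ∀ {p q} {A : Set p} {B : Set q} (g : B → Carrier) (k : A → List B) xs →
    sumL (map g (concatMap k xs)) ≈ sumL (map (λ x → sumL (map g (k x))) xs)
  sumL-concatMap g k []       = refl
  sumL-concatMap g k (x ∷ xs) = begin
    sumL (map g (k x ++ concatMap k xs))          ≡⟨ ≡.cong sumL (map-++ g (k x) (concatMap k xs)) ⟩
    sumL (map g (k x) ++ map g (concatMap k xs))  ≈⟨ sumL-++ (map g (k x)) _ ⟩
    sumL (map g (k x)) + sumL (map g (concatMap k xs)) ≈⟨ +-congˡ (sumL-concatMap g k xs) ⟩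
    sumL (map g (k x)) + sumL (map (λ y → sumL (map g (k y))) xs) ∎

  sumL-cong-∈ : ∀ {p} {A : Set p} {g h : A → Carrier} xs → (∀ {x} → x ∈ xs → g x ≈ h x) →
    sumL (map g xs) ≈ sumL (map h xs)
  sumL-cong-∈ []       _  = refl
  sumL-cong-∈ (x ∷ xs) eq = +-cong (eq (here ≡.refl)) (sumL-cong-∈ xs (eq ∘ there))

  sumL-zero-∈ : ∀ {p} {A : Set p} {g : A → Carrier} xs → (∀ {x} → x ∈ xs → g x ≈ 0#) → sumL (map g xs) ≈ 0#
  sumL-zero-∈ []       _  = refl
  sumL-zero-∈ (x ∷ xs) eq = trans (+-cong (eq (here ≡.refl)) (sumL-zero-∈ xs (eq ∘ there))) (+-identityʳ 0#)

  sumL-insertions : ∀ {m} (g : List ℕ → Carrier) zs → All (_< m) zs →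
    (∀ {z ys} → z < m → g (z ∷ ys) ≈ 0#) → sumL (map g (insertions m zs)) ≈ g (m ∷ zs)
  sumL-insertions g []       _           _      = +-identityʳ _
  sumL-insertions {m} g (z ∷ zs) (z<m ∷ _) vanish = begin
    g (m ∷ z ∷ zs) + sumL (map g (map (z ∷_) (insertions m zs))) ≡⟨ ≡.cong (λ s → g (m ∷ z ∷ zs) + sumL s) (map-∘ (insertions m zs)) ⟨
    g (m ∷ z ∷ zs) + sumL (map (g ∘ (z ∷_)) (insertions m zs))   ≈⟨ +-congˡ (sumL-zero-∈ (insertions m zs) (λ _ → vanish z<m)) ⟩
    g (m ∷ z ∷ zs) + 0#                                          ≈⟨ +-identityʳ _ ⟩
    g (m ∷ z ∷ zs)                                               ∎

  sumL-perms-concentrated : ∀ {μ} → Strict μ → (g : List ℕ → Carrier) → (∀ {ys} → ¬ μ ⊂ ys → g ys ≈ 0#) →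
    sumL (map g (perms μ)) ≈ g μ
  sumL-perms-concentrated {[]}     _ g _      = +-identityʳ _
  sumL-perms-concentrated {m ∷ μ} s g vanish = begin
    sumL (map g (concatMap (insertions m) (perms μ)))          ≈⟨ sumL-concatMap g (insertions m) (perms μ) ⟩
    sumL (map (λ zs → sumL (map g (insertions m zs))) (perms μ)) ≈⟨ sumL-cong-∈ (perms μ) insert-head ⟩
    sumL (map (g ∘ (m ∷_)) (perms μ))                          ≈⟨ sumL-perms-concentrated (strict-tail s) (g ∘ (m ∷_)) vanish-tail ⟩
    g (m ∷ μ)                                                  ∎
    where
    vanish-head : ∀ {z ys} → z < m → g (z ∷ ys) ≈ 0#
    vanish-head z<m = vanish λ { (⊂-∷ m≤z _) → <⇒≱ z<m m≤z }

    insert-head : ∀ {zs} → zs ∈ perms μ → sumL (map g (insertions m zs)) ≈ g (m ∷ zs)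
    insert-head {zs} zs∈ = sumL-insertions g zs
      (All-resp-↭ (↭-sym (∈-perms⇒↭ μ zs∈)) (strict-tail-<-head s)) vanish-head

    vanish-tail : ∀ {zs} → ¬ μ ⊂ zs → g (m ∷ zs) ≈ 0#
    vanish-tail μ⊄zs = vanish λ { (⊂-∷ _ μ⊂zs) → μ⊄zs μ⊂zs }

module Evaluation {c ℓ} (F : Char0Field c ℓ) (a : ℕ → Char0Field.Carrier F) where
  open Char0Field F
  open FactorialQ F
  open Sums F
  open import Relation.Binary.Reasoning.Setoid setoid
  open import Algebra.Properties.CommutativeSemigroup *-commutativeSemigroup using (interchange)

  fpow-vanishes : ∀ {k} m → k < m → fpow a (a (suc k)) m ≈ 0#
  fpow-vanishes (suc m) k<1+m with m<1+n⇒m<n∨m≡n k<1+m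
  ... | inj₁ k<m    = trans (*-congʳ (fpow-vanishes m k<m)) (zeroˡ _)
  ... | inj₂ ≡.refl = trans (*-congˡ (-‿inverseʳ _)) (zeroʳ _)

  term-vanishes : ∀ μ ks → ¬ μ ⊂ ks → term a μ (xOf a ks) ≈ 0#
  term-vanishes []      _        μ⊄ks = contradiction ⊂-[] μ⊄ks
  term-vanishes (m ∷ μ) []       _    = refl
  term-vanishes (m ∷ μ) (k ∷ ks) μ⊄ks with m ≤? k
  ... | no m≰k  = trans (*-congʳ (trans (*-congʳ (fpow-vanishes m (≰⇒> m≰k))) (zeroˡ _))) (zeroˡ _)
  ... | yes m≤k = trans (*-congˡ (term-vanishes μ ks (μ⊄ks ∘ ⊂-∷ m≤k))) (zeroʳ _)

  term-diagonal : ∀ μ → term a μ (xOf a μ) ≈ H a μ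
  term-diagonal []      = sym (*-identityˡ 1#)
  term-diagonal (m ∷ μ) = trans (*-congˡ (term-diagonal μ)) (interchange _ _ _ _)

  ofℕ-1⁻¹≈1# : ofℕ commutativeRing 1 ⁻¹ ≈ 1#
  ofℕ-1⁻¹≈1# = begin
    ofℕ commutativeRing 1 ⁻¹                           ≈⟨ *-identityˡ _ ⟨
    1# * ofℕ commutativeRing 1 ⁻¹                      ≈⟨ *-congʳ (+-identityʳ 1#) ⟨
    ofℕ commutativeRing 1 * ofℕ commutativeRing 1 ⁻¹   ≈⟨ inverse _ (char0 0) ⟩
    1#                                                 ∎

  P-≈0 : ∀ μ xs → (∀ {ys} → ys ∈ perms xs → term a μ ys ≈ 0#) → P a μ xs ≈ 0#
  P-≈0 μ xs vanish with length μ ≤? length xs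
  ... | no _  = refl
  ... | yes _ = trans (*-congˡ (sumL-zero-∈ (perms xs) vanish)) (zeroʳ _)

  P-full-length : ∀ μ xs → length μ ≡ length xs → P a μ xs ≈ sumL (map (term a μ) (perms xs))
  P-full-length μ xs len with length μ ≤? length xs
  ... | no μ≰xs = contradiction (≤-reflexive len) μ≰xs
  ... | yes _   = begin
    ofℕ commutativeRing (factorial (length xs ∸ length μ)) ⁻¹ * S
      ≡⟨ ≡.cong (λ n → ofℕ commutativeRing (factorial n) ⁻¹ * S) no-missing-variables ⟩
    ofℕ commutativeRing 1 ⁻¹ * S   ≈⟨ *-congʳ ofℕ-1⁻¹≈1# ⟩
    1# * S                         ≈⟨ *-identityˡ S ⟩
    S                              ∎
    where
    S : Carrier
    S = sumL (map (term a μ) (perms xs))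
    no-missing-variables : length xs ∸ length μ ≡ 0
    no-missing-variables = ≡.trans (≡.cong (length xs ∸_) len) (n∸n≡0 (length xs))

  term-vanishes-on-orderings : ∀ {μ λ′ ys} → Strict μ → Strict λ′ → ¬ μ ⊂ λ′ →
    ys ∈ perms (xOf a λ′) → term a μ ys ≈ 0#
  term-vanishes-on-orderings {μ} {λ′} sμ sλ μ⊄λ ys∈
    rewrite perms-map (λ k → a (suc k)) λ′ with ∈-map⁻ (xOf a) ys∈
  ... | ks , ks∈ , ≡.refl = term-vanishes μ ks (μ⊄λ ∘ ⊂-perms sλ ks∈ sμ)

  P-diagonal : ∀ {μ} → Strict μ → P a μ (xOf a μ) ≈ H a μ
  P-diagonal {μ} sμ = begin
    P a μ (xOf a μ)                                  ≈⟨ P-full-length μ (xOf a μ) (≡.sym (length-map _ μ)) ⟩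
    sumL (map (term a μ) (perms (xOf a μ)))          ≡⟨ ≡.cong (sumL ∘ map (term a μ)) (perms-map _ μ) ⟩
    sumL (map (term a μ) (map (xOf a) (perms μ)))    ≡⟨ ≡.cong sumL (map-∘ (perms μ)) ⟨
    sumL (map (term a μ ∘ xOf a) (perms μ))          ≈⟨ sumL-perms-concentrated sμ _ (term-vanishes μ _) ⟩
    term a μ (xOf a μ)                               ≈⟨ term-diagonal μ ⟩
    H a μ                                            ∎

theorem5p3 : ∀ {c ℓ} (F : Char0Field c ℓ) → let open Char0Field F in let open FactorialQ F in
    (a : ℕ → Carrier) → Admissible a →
      ((μ λ′ : List ℕ) → Strict μ → Strict λ′ → ¬ (μ ⊂ λ′) →
        (Q a μ (xOf a λ′) ≈ 0#) × (P a μ (xOf a λ′) ≈ 0#))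
      × ((μ : List ℕ) → Strict μ → P a μ (xOf a μ) ≈ H a μ)
theorem5p3 F a _ = vanishing , λ _ → P-diagonal
  where
  open Char0Field F
  open FactorialQ F
  open Evaluation F a

  vanishing : ∀ μ λ′ → Strict μ → Strict λ′ → ¬ μ ⊂ λ′ → (Q a μ (xOf a λ′) ≈ 0#) × (P a μ (xOf a λ′) ≈ 0#)
  vanishing μ λ′ sμ sλ μ⊄λ = trans (*-congˡ P≈0) (zeroʳ _) , P≈0
    where
    P≈0 : P a μ (xOf a λ′) ≈ 0#
    P≈0 = P-≈0 μ (xOf a λ′) (term-vanishes-on-orderings sμ sλ μ⊄λ)
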